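{- Let $\tau\colon\mathcal{A}^*\to\mathcal{B}^*$ be a substitution that is $k$-decisive in $\mathbf{x}=(x_n)_{n\ge0}\in\mathcal{A}^{\mathbb{N}}$, with witnessing map $r\colon\mathcal{A}\to\mathcal{B}^k$, and write $\mathbf{y}=\tau(\mathbf{x})=(y_n)_{n\ge0}$. Suppose $w\in\mathcal{A}^*$ occurs at position $i$ in $\mathbf{x}$, and let $p=|\tau(x_0\cdots x_{i+|w|-1})|$. Then for every nonempty $u\in\mathcal{L}(\mathbf{y})$ with $|u|\le k+1$, $$\big|\tau(w)\,y_p y_{p+1}\cdots y_{p+|u|-2}\big|_u=\sum_{a\in\mathcal{A}}|w|_a\,q_{\tau,\mathbf{x}}(u,a).$$
   Context: A substitution $\tau\colon\mathcal{A}^*\to\mathcal{B}^*$ is $k$-decisive in $\mathbf{x}$ if there is $r\colon\mathcal{A}\to\mathcal{B}^k$ such that $\tau(b)$ begins with $r(a)$ for all letters $a,b$ with $ab$ a factor of $\mathbf{x}$. For $u\in\mathcal{B}^*$ with $1\le|u|\le k+1$ and $a\in\mathcal{A}$, let $r_{|u|}(a)$ be the prefix of length $|u|-1$ of $r(a)$ and $q_{\tau,\mathbf{x}}(u,a)=|\tau(a)\,r_{|u|}(a)|_u$. Here $|s|_u$ is the number of (possibly overlapping) occurrences of $u$ in $s$, and $|w|_a$ the number of occurrences of the letter $a$ in $w$. -}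

module Defs where

open import Data.Nat using (ℕ; zero; suc; _+_; _*_; _∸_; _≤_)
open import Data.Fin using (Fin)
open import Data.Fin.Properties renaming (_≟_ to _≟ᶠ_)
open import Data.List using (List; []; _∷_; _++_; length; take; map; concatMap; upTo; allFin)
open import Data.List.Properties using (≡-dec)
open import Data.Vec using (Vec; toList)
open import Data.Product using (∃; _×_)
open import Data.Bool using (if_then_else_)
open import Relation.Nullary.Decidable using (does)
open import Relation.Binary.PropositionalEquality using (_≡_)

window : {T : Set} → (ℕ → T) → ℕ → ℕ → List T
window z i n = map (λ j → z (i + j)) (upTo n)

pref : {T : Set} → (ℕ → T) → ℕ → List T
pref z n = window z 0 n

subst* : ∀ {m n} → (Fin m → List (Fin n)) → List (Fin m) → List (Fin n)
subst* τ w = concatMap τ w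

isPrefix : ∀ {n} → List (Fin n) → List (Fin n) → ℕ
isPrefix u s = if does (≡-dec _≟ᶠ_ (take (length u) s) u) then 1 else 0

-- |s|_u : number of (possibly overlapping) occurrences of u in s,
-- i.e. number of positions j (0 ≤ j ≤ |s|) such that u is a prefix of s_j s_{j+1} ...
occ : ∀ {n} → List (Fin n) → List (Fin n) → ℕ
occ u [] = isPrefix u []
occ u (c ∷ s) = isPrefix u (c ∷ s) + occ u s

Decisive : ∀ {m n} (k : ℕ) → (Fin m → List (Fin n)) → (ℕ → Fin m) → (Fin m → Vec (Fin n) k) → Set
Decisive k τ x r = ∀ a b → (∃ λ j → x j ≡ a × x (suc j) ≡ b) → ∃ λ s → τ b ≡ toList (r a) ++ s

q : ∀ {m n k} → (Fin m → List (Fin n)) → (Fin m → Vec (Fin n) k) → List (Fin n) → Fin m → ℕ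
q τ r u a = occ u (τ a ++ take (length u ∸ 1) (toList (r a)))

{-# OPTIONS --safe #-}
-- Cut τ(w) y_p ⋯ y_{p+|u|-2} into the blocks τ(a), one for each letter a of w, and
-- charge each occurrence of u to the block in which it starts. An occurrence starting
-- in the block of x_j reads at most |u| - 1 ≤ k letters beyond it, and in y these are
-- the first letters of τ(x_{j+1}), which begins with r(x_j) by decisiveness. Hence
-- the block of x_j carries exactly q(u, x_j) occurrences, and summing over the
-- blocks gives the formula.
module Submission where

open import Defs
open import Data.Nat using (ℕ; zero; suc; _+_; _*_; _∸_; _≤_; _<_; s≤s)
open import Data.Nat.Properties
open import Data.Nat.ListAction using (sum)
open import Algebra.Properties.CommutativeSemigroup +-commutativeSemigroup using (interchange)
open import Data.Fin using (Fin) renaming (zero to fzero; suc to fsuc)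
open import Data.Fin.Properties using () renaming (_≟_ to _≟ᶠ_)
open import Data.List using (List; _∷_; []; _++_; length; map; allFin; take; upTo; applyUpTo)
open import Data.List.Properties
  using (≡-dec; ++-assoc; ++-identityʳ; ++-cancelˡ; length-++; length-++-≤ˡ; length-map;
         length-take; length-upTo; take-take; take-all; map-∘; map-cong; map-applyUpTo;
         map-tabulate; concatMap-++; ∷-injective)
open import Data.Vec using (Vec; toList)
open import Data.Vec.Properties using (length-toList)
open import Data.Bool using (if_then_else_)
open import Data.Product using (∃; _×_; _,_)
open import Data.Empty using (⊥-elim)
open import Function using (_∘_)
open import Relation.Nullary using (yes; no)
open import Relation.Nullary.Decidable using (does)
open import Relation.Binary.PropositionalEquality
open ≡-Reasoning

module _ {A : Set} where

  length-take≤length : ∀ n (v : List A) → length (take n v) ≤ length v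
  length-take≤length n v = ≤-trans (≤-reflexive (length-take n v)) (m⊓n≤n n (length v))

  length-take≤n : ∀ n (v : List A) → length (take n v) ≤ n
  length-take≤n n v = ≤-trans (≤-reflexive (length-take n v)) (m⊓n≤m n (length v))

  take-++-≤ : ∀ {n} (s t : List A) → n ≤ length s → take n (s ++ t) ≡ take n s
  take-++-≤ {zero}  s       t _         = refl
  take-++-≤ {suc n} (e ∷ s) t (s≤s n≤s) = cong (e ∷_) (take-++-≤ s t n≤s)

  take-++-take : ∀ {n m} (s t : List A) → n ≤ m → take n (s ++ t) ≡ take n (s ++ take m t)
  take-++-take {n} {m} [] t n≤m =
    sym (trans (take-take n m t) (cong (λ i → take i t) (m≤n⇒m⊓n≡m n≤m)))
  take-++-take {zero}  (e ∷ s) t _   = refl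
  take-++-take {suc n} (e ∷ s) t n<m = cong (e ∷_) (take-++-take s t (<⇒≤ n<m))

module _ {T : Set} (z : ℕ → T) where

  OccursAt : ℕ → List T → Set
  OccursAt i w = window z i (length w) ≡ w

  length-window : ∀ i n → length (window z i n) ≡ n
  length-window i n = trans (length-map _ (upTo n)) (length-upTo n)

  window-suc : ∀ i n → window z i (suc n) ≡ z i ∷ window z (suc i) n
  window-suc i n = cong₂ _∷_ (cong z (+-identityʳ i)) (begin
      map (λ j → z (i + j)) (applyUpTo suc n)
    ≡⟨ cong (map (λ j → z (i + j))) (sym (map-applyUpTo (λ j → j) suc n)) ⟩
      map (λ j → z (i + j)) (map suc (upTo n))
    ≡⟨ sym (map-∘ (upTo n)) ⟩
      map (λ j → z (i + suc j)) (upTo n)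
    ≡⟨ map-cong (λ j → cong z (+-suc i j)) (upTo n) ⟩
      window z (suc i) n ∎)

  window-++ : ∀ i a b → window z i (a + b) ≡ window z i a ++ window z (i + a) b
  window-++ i zero    b = cong (λ h → window z h b) (sym (+-identityʳ i))
  window-++ i (suc a) b = begin
      window z i (suc (a + b))
    ≡⟨ window-suc i (a + b) ⟩
      z i ∷ window z (suc i) (a + b)
    ≡⟨ cong (z i ∷_) (window-++ (suc i) a b) ⟩
      z i ∷ window z (suc i) a ++ window z (suc i + a) b
    ≡⟨ cong (λ k → z i ∷ window z (suc i) a ++ window z k b) (sym (+-suc i a)) ⟩
      z i ∷ window z (suc i) a ++ window z (i + suc a) b
    ≡⟨ cong (_++ window z (i + suc a) b) (sym (window-suc i a)) ⟩
      window z i (suc a) ++ window z (i + suc a) b ∎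

  take-window : ∀ i {a b} → a ≤ b → take a (window z i b) ≡ window z i a
  take-window i {a} {b} a≤b = begin
      take a (window z i b)
    ≡⟨ cong (take a ∘ window z i) (sym (m+[n∸m]≡n a≤b)) ⟩
      take a (window z i (a + (b ∸ a)))
    ≡⟨ cong (take a) (window-++ i a (b ∸ a)) ⟩
      take a (window z i a ++ window z (i + a) (b ∸ a))
    ≡⟨ take-++-≤ (window z i a) _ (≤-reflexive (sym (length-window i a))) ⟩
      take a (window z i a)
    ≡⟨ take-all a (window z i a) (≤-reflexive (length-window i a)) ⟩
      window z i a ∎

  window-≡-take : ∀ {i l} {v : List T} → OccursAt i v → l ≤ length v →
    window z i l ≡ take l v
  window-≡-take {i} {l} {v} v-at-i l≤v = begin
      window z i l                 ≡⟨ sym (take-window i l≤v) ⟩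
      take l (window z i (length v)) ≡⟨ cong (take l) v-at-i ⟩
      take l v                     ∎

  occursAt-letter : ∀ i → OccursAt i (z i ∷ [])
  occursAt-letter i = cong (λ j → z j ∷ []) (+-identityʳ i)

  occursAt-∷ : ∀ {i a w} → OccursAt i (a ∷ w) → z i ≡ a × OccursAt (suc i) w
  occursAt-∷ {i} {a} {w} a∷w-at-i =
    ∷-injective (trans (sym (window-suc i (length w))) a∷w-at-i)

  occursAt-after-prefixes : ∀ (s t : List T) → pref z (length s) ≡ s →
    pref z (length (s ++ t)) ≡ s ++ t → OccursAt (length s) t
  occursAt-after-prefixes s t s-pref s++t-pref = ++-cancelˡ s _ _ (begin
      s ++ window z (length s) (length t)
    ≡⟨ cong (_++ window z (length s) (length t)) (sym s-pref) ⟩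
      pref z (length s) ++ window z (length s) (length t)
    ≡⟨ sym (window-++ 0 (length s) (length t)) ⟩
      pref z (length s + length t)
    ≡⟨ cong (pref z) (sym (length-++ s)) ⟩
      pref z (length (s ++ t))
    ≡⟨ s++t-pref ⟩
      s ++ t ∎)

module _ {n : ℕ} where

  isPrefix-take : ∀ (u : List (Fin n)) {v v'} → take (length u) v ≡ take (length u) v' →
    isPrefix u v ≡ isPrefix u v'
  isPrefix-take u = cong (λ t → if does (≡-dec _≟ᶠ_ t u) then 1 else 0)

  isPrefix-short : ∀ (u v : List (Fin n)) → length v < length u → isPrefix u v ≡ 0
  isPrefix-short u v v<u with ≡-dec _≟ᶠ_ (take (length u) v) u
  ... | yes u≡ = ⊥-elim (<⇒≱ v<u u≤v)
    where
    u≤v : length u ≤ length v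
    u≤v = subst (λ t → length t ≤ length v) u≡ (length-take≤length (length u) v)
  ... | no _   = refl

  occ-short : ∀ (u v : List (Fin n)) → length v < length u → occ u v ≡ 0
  occ-short u []      v<u = isPrefix-short u [] v<u
  occ-short u (d ∷ v) v<u =
    cong₂ _+_ (isPrefix-short u (d ∷ v) v<u) (occ-short u v (<⇒≤ v<u))

  -- Occurrences of c ∷ u' in s ++ t starting inside s see at most length u' letters of t.
  occ-++ : ∀ (c : Fin n) (u' s t : List (Fin n)) →
    occ (c ∷ u') (s ++ t) ≡ occ (c ∷ u') (s ++ take (length u') t) + occ (c ∷ u') t
  occ-++ c u' [] t =
    cong (_+ occ (c ∷ u') t)
         (sym (occ-short (c ∷ u') (take (length u') t) (s≤s (length-take≤n (length u') t))))
  occ-++ c u' (d ∷ s) t = begin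
      isPrefix u (d ∷ s ++ t) + occ u (s ++ t)
    ≡⟨ cong₂ _+_ (isPrefix-take u (cong (d ∷_) (take-++-take s t ≤-refl))) (occ-++ c u' s t) ⟩
      isPrefix u (d ∷ s ++ take l t) + (occ u (s ++ take l t) + occ u t)
    ≡⟨ sym (+-assoc (isPrefix u (d ∷ s ++ take l t)) _ _) ⟩
      isPrefix u (d ∷ s ++ take l t) + occ u (s ++ take l t) + occ u t ∎
    where
    u = c ∷ u'
    l = length u'

module _ {A : Set} where

  sum-map-zero : ∀ (xs : List A) → sum (map (λ _ → 0) xs) ≡ 0
  sum-map-zero []       = refl
  sum-map-zero (_ ∷ xs) = sum-map-zero xs

  sum-map-+ : ∀ (g h : A → ℕ) xs →
    sum (map (λ a → g a + h a) xs) ≡ sum (map g xs) + sum (map h xs)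
  sum-map-+ g h []       = refl
  sum-map-+ g h (a ∷ xs) =
    trans (cong (g a + h a +_) (sum-map-+ g h xs)) (interchange (g a) (h a) _ _)

map-allFin-suc : ∀ {m} {A : Set} (g : Fin (suc m) → A) →
  map g (allFin (suc m)) ≡ g fzero ∷ map (g ∘ fsuc) (allFin m)
map-allFin-suc g =
  cong (g fzero ∷_) (trans (map-tabulate fsuc g) (sym (map-tabulate (λ a → a) (g ∘ fsuc))))

sum-isPrefix-letter : ∀ {m} (b : Fin m) (f : Fin m → ℕ) →
  sum (map (λ a → isPrefix (a ∷ []) (b ∷ []) * f a) (allFin m)) ≡ f b
sum-isPrefix-letter {suc m} fzero f = begin
    sum (map (λ a → isPrefix (a ∷ []) (fzero ∷ []) * f a) (allFin (suc m)))
  ≡⟨ cong sum (map-allFin-suc (λ a → isPrefix (a ∷ []) (fzero ∷ []) * f a)) ⟩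
    1 * f fzero + sum (map (λ _ → 0) (allFin m))
  ≡⟨ cong₂ _+_ (*-identityˡ (f fzero)) (sum-map-zero (allFin m)) ⟩
    f fzero + 0
  ≡⟨ +-identityʳ (f fzero) ⟩
    f fzero ∎
sum-isPrefix-letter {suc m} (fsuc b) f =
  trans (cong sum (map-allFin-suc (λ a → isPrefix (a ∷ []) (fsuc b ∷ []) * f a)))
        (sum-isPrefix-letter b (f ∘ fsuc))

sum-letterCount : ∀ {m} (f : Fin m → ℕ) (w : List (Fin m)) →
  sum (map (λ a → occ (a ∷ []) w * f a) (allFin m)) ≡ sum (map f w)
sum-letterCount {m} f []      = sum-map-zero (allFin m)
sum-letterCount {m} f (b ∷ w) = begin
    sum (map (λ a → (δ a + count a) * f a) (allFin m))
  ≡⟨ cong sum (map-cong (λ a → *-distribʳ-+ (f a) (δ a) (count a)) (allFin m)) ⟩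
    sum (map (λ a → δ a * f a + count a * f a) (allFin m))
  ≡⟨ sum-map-+ (λ a → δ a * f a) (λ a → count a * f a) (allFin m) ⟩
    sum (map (λ a → δ a * f a) (allFin m)) + sum (map (λ a → count a * f a) (allFin m))
  ≡⟨ cong₂ _+_ (sum-isPrefix-letter b f) (sum-letterCount f w) ⟩
    f b + sum (map f w) ∎
  where
  δ count : Fin m → ℕ
  δ a = isPrefix (a ∷ []) (b ∷ [])
  count a = occ (a ∷ []) w

module SubstitutedWord {m n} (τ : Fin m → List (Fin n)) (x : ℕ → Fin m) (y : ℕ → Fin n)
  (y≡τx : ∀ N → pref y (length (subst* τ (pref x N))) ≡ subst* τ (pref x N)) where

  pos : ℕ → ℕ
  pos j = length (subst* τ (pref x j))

  subst*-pref-++ : ∀ {j w} → OccursAt x j w →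
    subst* τ (pref x (j + length w)) ≡ subst* τ (pref x j) ++ subst* τ w
  subst*-pref-++ {j} {w} w-at-j = begin
      subst* τ (pref x (j + length w))
    ≡⟨ cong (subst* τ) (window-++ x 0 j (length w)) ⟩
      subst* τ (pref x j ++ window x j (length w))
    ≡⟨ concatMap-++ τ (pref x j) _ ⟩
      subst* τ (pref x j) ++ subst* τ (window x j (length w))
    ≡⟨ cong (λ v → subst* τ (pref x j) ++ subst* τ v) w-at-j ⟩
      subst* τ (pref x j) ++ subst* τ w ∎

  pos-++ : ∀ {j w} → OccursAt x j w → pos (j + length w) ≡ pos j + length (subst* τ w)
  pos-++ {j} w-at-j =
    trans (cong length (subst*-pref-++ w-at-j)) (length-++ (subst* τ (pref x j)))

  occursAt-image : ∀ {j w} → OccursAt x j w → OccursAt y (pos j) (subst* τ w)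
  occursAt-image {j} {w} w-at-j = occursAt-after-prefixes y _ _ (y≡τx j)
    (subst (λ v → pref y (length v) ≡ v) (subst*-pref-++ w-at-j) (y≡τx (j + length w)))

  image-++-window : ∀ {j w} → OccursAt x j w → ∀ l →
    subst* τ w ++ window y (pos (j + length w)) l ≡ window y (pos j) (length (subst* τ w) + l)
  image-++-window {j} {w} w-at-j l = begin
      subst* τ w ++ window y (pos (j + length w)) l
    ≡⟨ cong₂ (λ v i → v ++ window y i l) (sym (occursAt-image w-at-j)) (pos-++ w-at-j) ⟩
      window y (pos j) (length (subst* τ w)) ++ window y (pos j + length (subst* τ w)) l
    ≡⟨ sym (window-++ y (pos j) (length (subst* τ w)) l) ⟩
      window y (pos j) (length (subst* τ w) + l) ∎

  take-image-++-window : ∀ {j w} → OccursAt x j w → ∀ l →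
    take l (subst* τ w ++ window y (pos (j + length w)) l) ≡ window y (pos j) l
  take-image-++-window w-at-j l =
    trans (cong (take l) (image-++-window w-at-j l)) (take-window y _ (m≤n+m l _))

  module _ {k} {r : Fin m → Vec (Fin n) k} (decisive : Decisive k τ x r) where

    window-after-letter : ∀ j {l} → l ≤ k →
      window y (pos (suc j)) l ≡ take l (toList (r (x j)))
    window-after-letter j {l} l≤k with decisive (x j) (x (suc j)) (j , refl , refl)
    ... | s , τx′≡ = begin
        window y (pos (suc j)) l
      ≡⟨ window-≡-take y (occursAt-image (occursAt-letter x (suc j))) l≤τx′ ⟩
        take l (τ (x (suc j)) ++ [])
      ≡⟨ cong (take l) τx′++[]≡ ⟩
        take l (toList (r (x j)) ++ s)
      ≡⟨ take-++-≤ (toList (r (x j))) s l≤r ⟩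
        take l (toList (r (x j))) ∎
      where
      τx′++[]≡ : τ (x (suc j)) ++ [] ≡ toList (r (x j)) ++ s
      τx′++[]≡ = trans (++-identityʳ _) τx′≡
      l≤r : l ≤ length (toList (r (x j)))
      l≤r = ≤-trans l≤k (≤-reflexive (sym (length-toList (r (x j)))))
      l≤τx′ : l ≤ length (τ (x (suc j)) ++ [])
      l≤τx′ = ≤-trans l≤r (subst (λ v → length (toList (r (x j))) ≤ length v)
                                 (sym τx′++[]≡) (length-++-≤ˡ (toList (r (x j)))))

    occ-image-++-window : ∀ (c : Fin n) (u' : List (Fin n)) → length u' ≤ k →
      ∀ {j} w → OccursAt x j w →
      occ (c ∷ u') (subst* τ w ++ window y (pos (j + length w)) (length u'))
        ≡ sum (map (q τ r (c ∷ u')) w)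
    occ-image-++-window c u' u'≤k {j} [] _ =
      occ-short (c ∷ u') (window y (pos (j + 0)) (length u'))
                (s≤s (≤-reflexive (length-window y _ _)))
    occ-image-++-window c u' u'≤k {j} (a ∷ w) a∷w-at-j with occursAt-∷ x a∷w-at-j
    ... | refl , w-at-sj = begin
        occ u ((τ a ++ subst* τ w) ++ window y (pos (j + suc (length w))) l)
      ≡⟨ cong (λ i → occ u ((τ a ++ subst* τ w) ++ window y (pos i) l)) (+-suc j (length w)) ⟩
        occ u ((τ a ++ subst* τ w) ++ rest)
      ≡⟨ cong (occ u) (++-assoc (τ a) (subst* τ w) rest) ⟩
        occ u (τ a ++ subst* τ w ++ rest)
      ≡⟨ occ-++ c u' (τ a) (subst* τ w ++ rest) ⟩
        occ u (τ a ++ take l (subst* τ w ++ rest)) + occ u (subst* τ w ++ rest)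
      ≡⟨ cong₂ _+_ (cong (λ v → occ u (τ a ++ v)) next-letters)
                   (occ-image-++-window c u' u'≤k w w-at-sj) ⟩
        q τ r u a + sum (map (q τ r u) w) ∎
      where
      u = c ∷ u'
      l = length u'
      rest = window y (pos (suc j + length w)) l
      next-letters : take l (subst* τ w ++ rest) ≡ take l (toList (r a))
      next-letters = trans (take-image-++-window w-at-sj l) (window-after-letter j u'≤k)

open SubstitutedWord

proposition5p6 : ∀ {m n} (k : ℕ) (τ : Fin m → List (Fin n)) (x : ℕ → Fin m)
    (r : Fin m → Vec (Fin n) k) → Decisive k τ x r →
    (y : ℕ → Fin n) →
    (∀ N → pref y (length (subst* τ (pref x N))) ≡ subst* τ (pref x N)) →
    (∀ M → ∃ λ N → M ≤ length (subst* τ (pref x N))) →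
    (w : List (Fin m)) (i : ℕ) → window x i (length w) ≡ w →
    (u : List (Fin n)) → 1 ≤ length u → length u ≤ suc k → (∃ λ j → window y j (length u) ≡ u) →
    let p = length (subst* τ (pref x (i + length w))) in
    occ u (subst* τ w ++ window y p (length u ∸ 1))
      ≡ sum (map (λ a → occ (a ∷ []) w * q τ r u a) (allFin m))
-- Matching s≤s on |u| ≤ k + 1 rules out u = [].
proposition5p6 k τ x r decisive y y≡τx _ w i w-at-i (c ∷ u') _ (s≤s u'≤k) _ =
  trans (occ-image-++-window τ x y y≡τx decisive c u' u'≤k w w-at-i)
        (sym (sum-letterCount (q τ r (c ∷ u')) w))
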